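{- Let $D$ be a rational number. The reduced cubic equation $y^3+y^2+D=0$ has three rational roots (counted with multiplicity) if and only if there is a rational number $w$ satisfying the sextic equation $$D\,(w^2+3)^3+4\,(w-1)^2\,(1+w)^2=0.$$ In this case the roots of the cubic equation $y^3+y^2+D=0$ are given by $$y_1=-\frac{2\,(w+1)}{w^2+3},\qquad y_2=\frac{2\,(w-1)}{w^2+3},\qquad y_3=\frac{1-w^2}{w^2+3}.$$ -}

module Defs where

open import Data.Integer.Base using (+_; -[1+_])
open import Data.Rational.Base
open import Data.Rational.Properties
import Data.Nat
open import Relation.Binary.PropositionalEquality

cubic : ℚ → ℚ → ℚ
cubic D y = y * y * y + y * y + D

sextic : ℚ → ℚ → ℚ
sextic D w =
  D * ((w * w + + 3 / 1) * (w * w + + 3 / 1) * (w * w + + 3 / 1))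
  + + 4 / 1 * ((w - 1ℚ) * (w - 1ℚ)) * ((1ℚ + w) * (1ℚ + w))

-- "The cubic has three rational roots counted with multiplicity":
-- it splits over ℚ as (y − y₁)(y − y₂)(y − y₃).
HasRoots : ℚ → ℚ → ℚ → ℚ → Set
HasRoots D y₁ y₂ y₃ = ∀ y → cubic D y ≡ (y - y₁) * (y - y₂) * (y - y₃)

ThreeRationalRoots : ℚ → Set
ThreeRationalRoots D = ∃[ y₁ ] ∃[ y₂ ] ∃[ y₃ ] HasRoots D y₁ y₂ y₃
  where open import Data.Product using (∃-syntax)

private
  neg-inv : ∀ p → - (- p) ≡ p
  neg-inv (mkℚ (+ 0) _ _) = refl
  neg-inv (mkℚ (+ (Data.Nat.suc n)) _ _) = refl
  neg-inv (mkℚ -[1+ n ] _ _) = refl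

  sq-nonNeg : ∀ w → NonNegative (w * w)
  sq-nonNeg w@(mkℚ (+ n) _ _) = nonNeg*nonNeg⇒nonNeg w w
  sq-nonNeg w@(mkℚ -[1+ n ] _ _) =
    subst NonNegative eq (nonNeg*nonNeg⇒nonNeg (- w) (- w))
    where
      eq : (- w) * (- w) ≡ w * w
      eq = trans (sym (neg-distribˡ-* w (- w)))
                 (trans (cong -_ (sym (neg-distribʳ-* w w))) (neg-inv (w * w)))

den : ℚ → ℚ
den w = w * w + + 3 / 1

den-nonZero : ∀ w → NonZero (den w)
den-nonZero w = pos⇒nonZero (den w) {{nonNeg+pos⇒pos (w * w) {{sq-nonNeg w}} (+ 3 / 1)}}

_/den_ : ℚ → ℚ → ℚ
x /den w = _÷_ x (den w) {{den-nonZero w}}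

root₁ root₂ root₃ : ℚ → ℚ
root₁ w = (- (+ 2 / 1 * (w + 1ℚ))) /den w
root₂ w = (+ 2 / 1 * (w - 1ℚ)) /den w
root₃ w = (1ℚ - w * w) /den w

-- Vieta: y₁, y₂, y₃ are the roots of y³ + y² + D exactly when
-- y₁ + y₂ + y₃ = −1, y₁y₂ + y₁y₃ + y₂y₃ = 0 and y₁y₂y₃ = −D.  Writing s = y₁ + y₂,
-- the first two conditions give y₃ = −1 − s, y₁y₂ = s(1 + s), hence D = s(1 + s)²
-- and (y₁ − y₂)² = −s(3s + 4).  So if s ≠ 0 (some pair sum is nonzero, as the three
-- pair sums add up to −2), then w = (y₁ − y₂)/s satisfies (w² + 3)s = −4, and
-- substituting s = −4/(w² + 3) into D = s(1 + s)² is exactly the sextic.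
-- Conversely, the sextic makes the paper's roots satisfy the Vieta relations.
module Submission where

open import Data.Empty using (⊥-elim)
open import Data.Integer.Base using (+_)
open import Data.List.Base using (_∷_; [])
open import Data.Product using (_×_; _,_; ∃-syntax)
open import Data.Rational.Base
open import Data.Rational.Properties
  using (_≟_; +-*-commutativeRing; +-0-group; *-inverseʳ; neg-injective)
open import Algebra.Properties.Group +-0-group
  using (inverseˡ-unique; inverseʳ-unique; x≈y⇒x∙y⁻¹≈ε)
open import Function.Bundles using (_⇔_; mk⇔)
open import Level using (0ℓ)
open import Relation.Binary.PropositionalEquality
open import Relation.Nullary using (yes; no)
open import Relation.Nullary.Decidable using (dec⇒maybe)
open import Tactic.RingSolver using (solve)
open import Tactic.RingSolver.Core.AlmostCommutativeRing
  using (AlmostCommutativeRing; fromCommutativeRing)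

open import Defs

open ≡-Reasoning

ℚ-ring : AlmostCommutativeRing 0ℓ 0ℓ
ℚ-ring = fromCommutativeRing +-*-commutativeRing (λ x → dec⇒maybe (0ℚ ≟ x))

quadratic≡0⇒coefficients≡0 : ∀ p q r → (∀ y → p * y * y + q * y + r ≡ 0ℚ) →
                             p ≡ 0ℚ × q ≡ 0ℚ × r ≡ 0ℚ
quadratic≡0⇒coefficients≡0 p q r vanishes = p≡0 , q≡0 , r≡0
  where
  p≡0 : p ≡ 0ℚ
  p≡0 = begin
    p
      ≡⟨ solve (p ∷ q ∷ r ∷ []) ℚ-ring ⟩
    ½ * ((p * 1ℚ * 1ℚ + q * 1ℚ + r) + (p * - 1ℚ * - 1ℚ + q * - 1ℚ + r))
      - (p * 0ℚ * 0ℚ + q * 0ℚ + r)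
      ≡⟨ cong₂ (λ u v → ½ * (u + v) - (p * 0ℚ * 0ℚ + q * 0ℚ + r))
               (vanishes 1ℚ) (vanishes (- 1ℚ)) ⟩
    ½ * (0ℚ + 0ℚ) - (p * 0ℚ * 0ℚ + q * 0ℚ + r)
      ≡⟨ cong (λ u → ½ * (0ℚ + 0ℚ) - u) (vanishes 0ℚ) ⟩
    0ℚ ∎

  q≡0 : q ≡ 0ℚ
  q≡0 = begin
    q
      ≡⟨ solve (p ∷ q ∷ r ∷ []) ℚ-ring ⟩
    ½ * ((p * 1ℚ * 1ℚ + q * 1ℚ + r) - (p * - 1ℚ * - 1ℚ + q * - 1ℚ + r))
      ≡⟨ cong₂ (λ u v → ½ * (u - v)) (vanishes 1ℚ) (vanishes (- 1ℚ)) ⟩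
    0ℚ ∎

  r≡0 : r ≡ 0ℚ
  r≡0 = begin
    r                         ≡⟨ solve (p ∷ q ∷ r ∷ []) ℚ-ring ⟩
    p * 0ℚ * 0ℚ + q * 0ℚ + r  ≡⟨ vanishes 0ℚ ⟩
    0ℚ                        ∎

record Vieta (D a b c : ℚ) : Set where
  field
    sum     : a + b + c ≡ - 1ℚ
    pairs   : a * b + a * c + b * c ≡ 0ℚ
    product : D ≡ - (a * b * c)

module _ {D a b c : ℚ} where

  vieta⇒hasRoots : Vieta D a b c → HasRoots D a b c
  vieta⇒hasRoots v y = sym (begin
    (y - a) * (y - b) * (y - c)
      ≡⟨ solve (y ∷ a ∷ b ∷ c ∷ []) ℚ-ring ⟩
    y * y * y - (a + b + c) * (y * y) + (a * b + a * c + b * c) * y - a * b * c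
      ≡⟨ cong₂ (λ σ₁ σ₂ → y * y * y - σ₁ * (y * y) + σ₂ * y - a * b * c) sum pairs ⟩
    y * y * y - - 1ℚ * (y * y) + 0ℚ * y - a * b * c
      ≡⟨ solve (y ∷ a ∷ b ∷ c ∷ []) ℚ-ring ⟩
    y * y * y + y * y + - (a * b * c)
      ≡⟨ cong (λ d → y * y * y + y * y + d) (sym product) ⟩
    cubic D y ∎)
    where open Vieta v

  hasRoots⇒vieta : HasRoots D a b c → Vieta D a b c
  hasRoots⇒vieta splits =
    let p≡0 , q≡0 , r≡0 = quadratic≡0⇒coefficients≡0 _ _ _ difference-vanishes in record
      { sum     = inverseʳ-unique 1ℚ (a + b + c) p≡0
      ; pairs   = neg-injective q≡0
      ; product = inverseˡ-unique D (a * b * c) r≡0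
      }
    where
    difference-vanishes : ∀ y → (1ℚ + (a + b + c)) * y * y
                                + - (a * b + a * c + b * c) * y + (D + a * b * c) ≡ 0ℚ
    difference-vanishes y = begin
      (1ℚ + (a + b + c)) * y * y + - (a * b + a * c + b * c) * y + (D + a * b * c)
        ≡⟨ solve (D ∷ y ∷ a ∷ b ∷ c ∷ []) ℚ-ring ⟩
      (y * y * y + y * y + D) - (y - a) * (y - b) * (y - c)
        ≡⟨ x≈y⇒x∙y⁻¹≈ε (splits y) ⟩
      0ℚ ∎

  vieta-swap₂₃ : Vieta D a b c → Vieta D a c b
  vieta-swap₂₃ v = record
    { sum     = begin
        a + c + b              ≡⟨ solve (a ∷ b ∷ c ∷ []) ℚ-ring ⟩
        a + b + c              ≡⟨ sum ⟩
        - 1ℚ                   ∎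
    ; pairs   = begin
        a * c + a * b + c * b  ≡⟨ solve (a ∷ b ∷ c ∷ []) ℚ-ring ⟩
        a * b + a * c + b * c  ≡⟨ pairs ⟩
        0ℚ                     ∎
    ; product = begin
        D                      ≡⟨ product ⟩
        - (a * b * c)          ≡⟨ solve (a ∷ b ∷ c ∷ []) ℚ-ring ⟩
        - (a * c * b)          ∎
    }
    where open Vieta v

  vieta-swap₁₃ : Vieta D a b c → Vieta D c b a
  vieta-swap₁₃ v = record
    { sum     = begin
        c + b + a              ≡⟨ solve (a ∷ b ∷ c ∷ []) ℚ-ring ⟩
        a + b + c              ≡⟨ sum ⟩
        - 1ℚ                   ∎
    ; pairs   = begin
        c * b + c * a + b * a  ≡⟨ solve (a ∷ b ∷ c ∷ []) ℚ-ring ⟩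
        a * b + a * c + b * c  ≡⟨ pairs ⟩
        0ℚ                     ∎
    ; product = begin
        D                      ≡⟨ product ⟩
        - (a * b * c)          ≡⟨ solve (a ∷ b ∷ c ∷ []) ℚ-ring ⟩
        - (c * b * a)          ∎
    }
    where open Vieta v

pair-sums-not-all-zero : ∀ {a b c} → a + b + c ≡ - 1ℚ →
                         a + b ≡ 0ℚ → a + c ≡ 0ℚ → b + c ≢ 0ℚ
pair-sums-not-all-zero {a} {b} {c} sum a+b≡0 a+c≡0 b+c≡0 = -1≢0 (begin
  - 1ℚ                              ≡⟨ sym sum ⟩
  a + b + c                         ≡⟨ solve (a ∷ b ∷ c ∷ []) ℚ-ring ⟩
  ½ * ((a + b) + (a + c) + (b + c)) ≡⟨ cong₂ (λ u v → ½ * (u + v + (b + c))) a+b≡0 a+c≡0 ⟩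
  ½ * (0ℚ + 0ℚ + (b + c))           ≡⟨ cong (λ u → ½ * (0ℚ + 0ℚ + u)) b+c≡0 ⟩
  0ℚ                                ∎)
  where
  -1≢0 : - 1ℚ ≢ 0ℚ
  -1≢0 ()

sextic-vanishes : ∀ {D w s} → den w * s ≡ - (+ 4 / 1) → D ≡ s * (1ℚ + s) * (1ℚ + s) →
                  sextic D w ≡ 0ℚ
sextic-vanishes {D} {w} {s} den*s≡-4 D≡ = begin
  sextic D w
    ≡⟨ cong (λ d → sextic d w) D≡ ⟩
  s * (1ℚ + s) * (1ℚ + s) * ((w * w + + 3 / 1) * (w * w + + 3 / 1) * (w * w + + 3 / 1))
    + + 4 / 1 * ((w - 1ℚ) * (w - 1ℚ)) * ((1ℚ + w) * (1ℚ + w))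
    ≡⟨ solve (w ∷ s ∷ []) ℚ-ring ⟩
  (w * w + + 3 / 1) * s
      * (w * w + + 3 / 1 + (w * w + + 3 / 1) * s) * (w * w + + 3 / 1 + (w * w + + 3 / 1) * s)
    + + 4 / 1 * (w * w - 1ℚ) * (w * w - 1ℚ)
    ≡⟨ cong (λ u → u * (w * w + + 3 / 1 + u) * (w * w + + 3 / 1 + u)
                   + + 4 / 1 * (w * w - 1ℚ) * (w * w - 1ℚ)) den*s≡-4 ⟩
  - (+ 4 / 1) * (w * w + + 3 / 1 - + 4 / 1) * (w * w + + 3 / 1 - + 4 / 1)
    + + 4 / 1 * (w * w - 1ℚ) * (w * w - 1ℚ)
    ≡⟨ solve (w ∷ []) ℚ-ring ⟩
  0ℚ ∎

module _ {D a b c : ℚ} (v : Vieta D a b c) where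
  open Vieta v

  vieta⇒sextic-vanishes : ∀ {i} → (a + b) * i ≡ 1ℚ → sextic D ((a - b) * i) ≡ 0ℚ
  vieta⇒sextic-vanishes {i} [a+b]*i≡1 =
    sextic-vanishes {w = (a - b) * i} {s = a + b} den*[a+b]≡-4 D≡
    where
    c≡ : c ≡ - 1ℚ - (a + b)
    c≡ = begin
      c                       ≡⟨ solve (a ∷ b ∷ c ∷ []) ℚ-ring ⟩
      (a + b + c) - (a + b)   ≡⟨ cong (λ σ₁ → σ₁ - (a + b)) sum ⟩
      - 1ℚ - (a + b)          ∎

    ab≡ : a * b ≡ (a + b) * (1ℚ + (a + b))
    ab≡ = begin
      a * b                                  ≡⟨ solve (a ∷ b ∷ c ∷ []) ℚ-ring ⟩
      (a * b + a * c + b * c) - (a + b) * c  ≡⟨ cong₂ (λ σ₂ x → σ₂ - (a + b) * x) pairs c≡ ⟩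
      0ℚ - (a + b) * (- 1ℚ - (a + b))        ≡⟨ solve (a ∷ b ∷ []) ℚ-ring ⟩
      (a + b) * (1ℚ + (a + b))               ∎

    D≡ : D ≡ (a + b) * (1ℚ + (a + b)) * (1ℚ + (a + b))
    D≡ = begin
      D                                                ≡⟨ product ⟩
      - (a * b * c)                                    ≡⟨ cong₂ (λ x y → - (x * y)) ab≡ c≡ ⟩
      - ((a + b) * (1ℚ + (a + b)) * (- 1ℚ - (a + b)))  ≡⟨ solve (a ∷ b ∷ []) ℚ-ring ⟩
      (a + b) * (1ℚ + (a + b)) * (1ℚ + (a + b))        ∎

    den*[a+b]≡-4 : den ((a - b) * i) * (a + b) ≡ - (+ 4 / 1)
    den*[a+b]≡-4 = begin
      ((a - b) * i * ((a - b) * i) + + 3 / 1) * (a + b)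
        ≡⟨ solve (a ∷ b ∷ i ∷ []) ℚ-ring ⟩
      ((a + b) * (a + b) - + 4 / 1 * (a * b)) * (i * i) * (a + b) + + 3 / 1 * (a + b)
        ≡⟨ cong (λ x → ((a + b) * (a + b) - + 4 / 1 * x) * (i * i) * (a + b)
                       + + 3 / 1 * (a + b)) ab≡ ⟩
      ((a + b) * (a + b) - + 4 / 1 * ((a + b) * (1ℚ + (a + b)))) * (i * i) * (a + b)
        + + 3 / 1 * (a + b)
        ≡⟨ solve (a ∷ b ∷ i ∷ []) ℚ-ring ⟩
      (- (+ 3 / 1) * (a + b) - + 4 / 1) * ((a + b) * i) * ((a + b) * i)
        + + 3 / 1 * (a + b)
        ≡⟨ cong (λ x → (- (+ 3 / 1) * (a + b) - + 4 / 1) * x * x + + 3 / 1 * (a + b))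
                [a+b]*i≡1 ⟩
      (- (+ 3 / 1) * (a + b) - + 4 / 1) * 1ℚ * 1ℚ + + 3 / 1 * (a + b)
        ≡⟨ solve (a ∷ b ∷ []) ℚ-ring ⟩
      - (+ 4 / 1) ∎

  pair-sum≢0⇒sextic-root : a + b ≢ 0ℚ → ∃[ w ] sextic D w ≡ 0ℚ
  pair-sum≢0⇒sextic-root a+b≢0 =
    (a - b) * 1/ (a + b) , vieta⇒sextic-vanishes (*-inverseʳ (a + b))
    where
    instance
      a+b-nonZero : NonZero (a + b)
      a+b-nonZero = ≢-nonZero a+b≢0

vieta⇒sextic-root : ∀ {D a b c} → Vieta D a b c → ∃[ w ] sextic D w ≡ 0ℚ
vieta⇒sextic-root {a = a} {b = b} {c = c} v with a + b ≟ 0ℚ | a + c ≟ 0ℚ | b + c ≟ 0ℚ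
... | no a+b≢0  | _         | _         = pair-sum≢0⇒sextic-root v a+b≢0
... | yes _     | no a+c≢0  | _         = pair-sum≢0⇒sextic-root (vieta-swap₂₃ v) a+c≢0
... | yes _     | yes _     | no b+c≢0  =
  pair-sum≢0⇒sextic-root (vieta-swap₁₃ (vieta-swap₂₃ v)) b+c≢0
... | yes a+b≡0 | yes a+c≡0 | yes b+c≡0 =
  ⊥-elim (pair-sums-not-all-zero {a} {b} {c} (Vieta.sum v) a+b≡0 a+c≡0 b+c≡0)

sextic-root⇒vieta : ∀ {D w i} → den w * i ≡ 1ℚ → sextic D w ≡ 0ℚ →
                    Vieta D (- (+ 2 / 1 * (w + 1ℚ)) * i) (+ 2 / 1 * (w - 1ℚ) * i)
                            ((1ℚ - w * w) * i)
sextic-root⇒vieta {D} {w} {i} den*i≡1 sextic≡0 = record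
  { sum     = begin
      - (+ 2 / 1 * (w + 1ℚ)) * i + + 2 / 1 * (w - 1ℚ) * i + (1ℚ - w * w) * i
        ≡⟨ solve (w ∷ i ∷ []) ℚ-ring ⟩
      - ((w * w + + 3 / 1) * i)
        ≡⟨ cong -_ den*i≡1 ⟩
      - 1ℚ ∎
  ; pairs   = solve (w ∷ i ∷ []) ℚ-ring
  ; product = begin
      D
        ≡⟨ solve (D ∷ []) ℚ-ring ⟩
      D * (1ℚ * 1ℚ * 1ℚ)
        ≡⟨ cong (λ x → D * (x * x * x)) (sym den*i≡1) ⟩
      D * ((w * w + + 3 / 1) * i * ((w * w + + 3 / 1) * i) * ((w * w + + 3 / 1) * i))
        ≡⟨ solve (D ∷ w ∷ i ∷ []) ℚ-ring ⟩
      D * ((w * w + + 3 / 1) * (w * w + + 3 / 1) * (w * w + + 3 / 1)) * (i * i * i)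
        ≡⟨ cong (λ x → x * (i * i * i)) D*den³≡-E ⟩
      - (+ 4 / 1 * ((w - 1ℚ) * (w - 1ℚ)) * ((1ℚ + w) * (1ℚ + w))) * (i * i * i)
        ≡⟨ solve (w ∷ i ∷ []) ℚ-ring ⟩
      - (- (+ 2 / 1 * (w + 1ℚ)) * i * (+ 2 / 1 * (w - 1ℚ) * i) * ((1ℚ - w * w) * i)) ∎
  }
  where
  D*den³≡-E : D * (den w * den w * den w)
              ≡ - (+ 4 / 1 * ((w - 1ℚ) * (w - 1ℚ)) * ((1ℚ + w) * (1ℚ + w)))
  D*den³≡-E = inverseˡ-unique _ _ sextic≡0

lemma2p1 : (D : ℚ) →
    (ThreeRationalRoots D ⇔ (∃[ w ] sextic D w ≡ 0ℚ))
    × (∀ w → sextic D w ≡ 0ℚ → HasRoots D (root₁ w) (root₂ w) (root₃ w))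
lemma2p1 D =
  mk⇔ (λ (_ , _ , _ , splits) → vieta⇒sextic-root (hasRoots⇒vieta splits))
      (λ (w , sextic≡0) → root₁ w , root₂ w , root₃ w , paper-roots w sextic≡0)
  , paper-roots
  where
  paper-roots : ∀ w → sextic D w ≡ 0ℚ → HasRoots D (root₁ w) (root₂ w) (root₃ w)
  paper-roots w sextic≡0 = vieta⇒hasRoots
    (sextic-root⇒vieta {w = w} (*-inverseʳ (den w) {{den-nonZero w}}) sextic≡0)
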